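{- Let $G$ be a finite graph and let $\mathcal P$ be any set of profiles of clique separations of $G$. For distinguishable $P,P'\in\mathcal P$ let $A_{P,P'}$ be the set of all clique separations of $G$ that distinguish $P$ and $P'$ efficiently. Then the collection $(A_{P,P'}\mid P,P'\in\mathcal P\text{ distinguishable})$ splinters.
   Context: A separation of $G=(V,E)$ is a pair $(A,B)$ with $A\cup B=V$ and no edge between $A\setminus B$ and $B\setminus A$; its inverse is $(B,A)$, its order is $|A\cap B|$, and $(A,B)\le(C,D)$ iff $A\subseteq C$, $B\supseteq D$; joins and meets are $(A\cup C,B\cap D)$ and $(A\cap C,B\cup D)$. The unoriented separation is $\{(A,B),(B,A)\}$. A clique separation is one with $G[A\cap B]$ complete; $S_k$ is the set of clique separations of order $<k$. A profile (of clique separations) of order $k$ is a set $P$ containing exactly one orientation of each element of $S_k$ which is consistent (no $\vec r,\vec s\in P$ with $\overleftarrow r<\vec s$) and satisfies: for all $\vec r,\vec s\in P$, $\overleftarrow r\wedge\overleftarrow s\notin P$. A clique separation distinguishes two profiles if they contain different orientations of it; it distinguishes them efficiently if it has minimal order among all clique separations distinguishing them; two profiles are distinguishable if some clique separation distinguishes them. Separations are nested if they have comparable orientations, otherwise they cross; corner separations of $r,s$ are the $\vec r\vee\vec s$ over all orientations. A family $(A_i)$ of non-empty sets of separations splinters if for every crossing pair $a_i\in A_i\setminus A_j$, $a_j\in A_j\setminus A_i$, some corner separation of $a_i,a_j$ lies in $A_i\cup A_j$. -}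

module Defs where

open import Level using (0ℓ)
open import Data.Nat using (ℕ; _≤_; _<_)
open import Data.Fin using (Fin)
open import Data.Fin.Subset using (Subset; _∈_; _∉_; _⊆_; _∩_; _∪_; ⊤; ∣_∣)
open import Data.Product using (_×_; _,_; proj₁; proj₂; Σ; ∃)
open import Data.Sum using (_⊎_)
open import Data.Empty using (⊥)
open import Relation.Nullary using (¬_)
open import Relation.Binary.PropositionalEquality using (_≡_; _≢_)

record Graph : Set₁ where
  field
    n      : ℕ
    E      : Fin n → Fin n → Set
    E-sym  : ∀ {u v} → E u v → E v u
    E-irr  : ∀ {u} → ¬ E u u

module _ (G : Graph) where
  open Graph G

  Sep : Set
  Sep = Subset n × Subset n

  inv : Sep → Sep
  inv (A , B) = (B , A)

  order : Sep → ℕ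
  order (A , B) = ∣ A ∩ B ∣

  IsSep : Sep → Set
  IsSep (A , B) =
    (A ∪ B ≡ ⊤) ×
    (∀ u v → u ∈ A → u ∉ B → v ∈ B → v ∉ A → ¬ E u v)

  IsCliqueSep : Sep → Set
  IsCliqueSep (A , B) =
    IsSep (A , B) ×
    (∀ u v → u ∈ A ∩ B → v ∈ A ∩ B → u ≢ v → E u v)

  _≤ₛ_ : Sep → Sep → Set
  (A , B) ≤ₛ (C , D) = (A ⊆ C) × (D ⊆ B)

  _<ₛ_ : Sep → Sep → Set
  r <ₛ s = (r ≤ₛ s) × (r ≢ s)

  _∨ₛ_ : Sep → Sep → Sep
  (A , B) ∨ₛ (C , D) = (A ∪ C , B ∩ D)

  _∧ₛ_ : Sep → Sep → Sep
  (A , B) ∧ₛ (C , D) = (A ∩ C , B ∪ D)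

  record IsProfile (k : ℕ) (P : Sep → Set) : Set where
    field
      P⊆Sk     : ∀ r → P r → IsCliqueSep r × order r < k
      orient   : ∀ r → IsCliqueSep r → order r < k → P r ⊎ P (inv r)
      unique   : ∀ r → P r → P (inv r) → r ≡ inv r
      consistent : ∀ r s → P r → P s → ¬ (inv r <ₛ s)
      profile  : ∀ r s → P r → P s → ¬ P (inv r ∧ₛ inv s)

  record Profile : Set₁ where
    field
      k    : ℕ
      P    : Sep → Set
      isProfile : IsProfile k P

  Distinguishes : Profile → Profile → Sep → Set
  Distinguishes π π' r =
    IsCliqueSep r × ((Profile.P π r × Profile.P π' (inv r)) ⊎ (Profile.P π (inv r) × Profile.P π' r))

  DistinguishesEff : Profile → Profile → Sep → Set
  DistinguishesEff π π' r =
    Distinguishes π π' r × (∀ t → Distinguishes π π' t → order r ≤ order t)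

  Distinguishable : Profile → Profile → Set
  Distinguishable π π' = ∃ λ r → Distinguishes π π' r

  Nested : Sep → Sep → Set
  Nested r s = (r ≤ₛ s) ⊎ (r ≤ₛ inv s) ⊎ (inv r ≤ₛ s) ⊎ (inv r ≤ₛ inv s)

  Cross : Sep → Sep → Set
  Cross r s = ¬ Nested r s

  IsCorner : Sep → Sep → Sep → Set
  IsCorner r s c =
    (c ≡ r ∨ₛ s) ⊎ (c ≡ r ∨ₛ inv s) ⊎ (c ≡ inv r ∨ₛ s) ⊎ (c ≡ inv r ∨ₛ inv s)

  -- A family of sets of (unoriented) separations, each set given as a
  -- predicate on oriented representatives closed under inversion, splinters.
  Splinters : (I : Set) → (I → Sep → Set) → Set
  Splinters I A =
    ∀ i j (a b : Sep) → A i a → ¬ A j a → A j b → ¬ A i b → Cross a b →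
    ∃ λ c → IsCorner a b c × (A i c ⊎ A j c)

  DPairs : (ι : Set) → (ι → Profile) → Set
  DPairs ι 𝒫 = Σ (ι × ι) λ pq → Distinguishable (𝒫 (proj₁ pq)) (𝒫 (proj₂ pq))

  Aeff : (ι : Set) (𝒫 : ι → Profile) → DPairs ι 𝒫 → Sep → Set
  Aeff ι 𝒫 ((p , q) , _) = DistinguishesEff (𝒫 p) (𝒫 q)

module Submission where

-- Let a and b be efficient distinguishers of two pairs of profiles, where a
-- does not distinguish the pair (Q , Q') of b efficiently, and assume
-- |a| ≤ |b| (the other case is symmetric).  Since a is a clique
-- separation of order < k, both Q and Q' orient a; if they oriented it
-- differently, a would distinguish them with order ≤ |b|, i.e. efficiently.
-- So some orientation α of a lies in both Q and Q', while some orientation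
-- β of b lies in Q with its inverse in Q'.  The separator of α is a clique,
-- hence lies on one side of β: if it lies in the first side of β, the corner
-- α ∨ β has its separator inside that of β, so it is a clique separation of
-- order ≤ |b|; the profile axioms then force α ∨ β ∈ Q and its inverse into
-- Q', so it distinguishes Q, Q' efficiently.  Otherwise the same holds for
-- α ∨ β⁻¹ with the roles of Q and Q' exchanged.

open import Defs
open import Data.Nat using (ℕ; _≤_; _<_)
open import Data.Nat.Properties using (≤-trans; ≤-reflexive; ≤-total; ≤-<-trans)
open import Data.Fin.Properties using (any?)
open import Data.Fin.Subset using (Subset; _∈_; _∉_; _⊆_; _∩_; _∪_; ⊤; ∣_∣)
open import Data.Fin.Subset.Properties
  using (_∈?_; ∈⊤; ⊆-antisym; x∈p∪q⁺; x∈p∪q⁻; x∈p∩q⁺; x∈p∩q⁻;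
         ∪-comm; ∩-comm; ∪-idem; ∩-idem; q⊆p∪q; p∩q⊆q; p⊆q⇒∣p∣≤∣q∣)
open import Data.Product using (_×_; _,_; proj₁; proj₂; ∃)
open import Data.Sum using (_⊎_; inj₁; inj₂)
open import Data.Empty using (⊥-elim)
open import Relation.Nullary using (¬_; yes; no)
open import Relation.Nullary.Decidable using (_×-dec_; ¬?)
open import Relation.Binary.PropositionalEquality
  using (_≡_; _≢_; refl; sym; trans; cong; cong₂; subst)

module _ (G : Graph) where
  open Graph G
  open Profile using (k; P)
  module Prof (Q : Profile G) = IsProfile (Profile.isProfile Q)

  _∨_ : Sep G → Sep G → Sep G
  _∨_ = _∨ₛ_ G

  IsClique : Subset n → Set
  IsClique K = ∀ u v → u ∈ K → v ∈ K → u ≢ v → E u v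

  Orients : Sep G → Sep G → Set
  Orients r α = α ≡ r ⊎ α ≡ inv G r

  LowerBound : Profile G → Profile G → ℕ → Set
  LowerBound Q Q' m = ∀ t → Distinguishes G Q Q' t → m ≤ order G t

  side : ∀ {A B : Subset n} → A ∪ B ≡ ⊤ → ∀ x → x ∈ A ⊎ x ∈ B
  side {A} {B} A∪B≡⊤ x = x∈p∪q⁻ A B (subst (x ∈_) (sym A∪B≡⊤) ∈⊤)

  left-side : ∀ {A B : Subset n} {x} → A ∪ B ≡ ⊤ → x ∉ B → x ∈ A
  left-side {x = x} A∪B≡⊤ x∉B with side A∪B≡⊤ x
  ... | inj₁ x∈A = x∈A
  ... | inj₂ x∈B = ⊥-elim (x∉B x∈B)

  order-inv : ∀ r → order G (inv G r) ≡ order G r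
  order-inv (A , B) = cong ∣_∣ (∩-comm B A)

  inv-isCliqueSep : ∀ r → IsCliqueSep G r → IsCliqueSep G (inv G r)
  inv-isCliqueSep (A , B) ((A∪B≡⊤ , noEdge) , clique) =
    (trans (∪-comm B A) A∪B≡⊤ ,
     λ u v u∈B u∉A v∈A v∉B uv → noEdge v u v∈A v∉B u∈B u∉A (E-sym uv)) ,
    λ u v u∈ v∈ → clique u v (subst (u ∈_) (∩-comm B A) u∈) (subst (v ∈_) (∩-comm B A) v∈)

  orients-order : ∀ {r α} → Orients r α → order G α ≡ order G r
  orients-order (inj₁ refl) = refl
  orients-order {r} (inj₂ refl) = order-inv r

  orients-isCliqueSep : ∀ {r α} → Orients r α → IsCliqueSep G r → IsCliqueSep G α
  orients-isCliqueSep (inj₁ refl) cs = cs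
  orients-isCliqueSep {r} (inj₂ refl) cs = inv-isCliqueSep r cs

  -- A clique lies entirely on one side of any separation: a vertex of K in
  -- C ∖ D and one in D ∖ C would be adjacent across the separation.
  clique-side : ∀ {C D K} → IsSep G (C , D) → IsClique K → K ⊆ C ⊎ K ⊆ D
  clique-side {C} {D} {K} (C∪D≡⊤ , noEdge) clique
    with any? (λ u → (u ∈? K) ×-dec ¬? (u ∈? C))
  ... | no none-outside = inj₁ inside
    where
    inside : K ⊆ C
    inside {v} v∈K with v ∈? C
    ... | yes v∈C = v∈C
    ... | no v∉C = ⊥-elim (none-outside (v , v∈K , v∉C))
  ... | yes (u , u∈K , u∉C) = inj₂ inside
    where
    u∈D : u ∈ D
    u∈D with side C∪D≡⊤ u
    ... | inj₁ u∈C = ⊥-elim (u∉C u∈C)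
    ... | inj₂ u∈D = u∈D
    inside : K ⊆ D
    inside {v} v∈K with v ∈? D
    ... | yes v∈D = v∈D
    ... | no v∉D =
      ⊥-elim (noEdge v u v∈C v∉D u∈D u∉C
                (clique v u v∈K u∈K (λ v≡u → u∉C (subst (_∈ C) v≡u v∈C))))
      where
      v∈C : v ∈ C
      v∈C = left-side C∪D≡⊤ v∉D

  join-isSep : ∀ {A B C D : Subset n} → IsSep G (A , B) → IsSep G (C , D) → IsSep G ((A , B) ∨ (C , D))
  join-isSep {A} {B} {C} {D} (A∪B≡⊤ , noEdge₁) (C∪D≡⊤ , noEdge₂) = covers , noEdge
    where
    covers : (A ∪ C) ∪ (B ∩ D) ≡ ⊤
    covers = ⊆-antisym (λ _ → ∈⊤) (λ {x} _ → covered x)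
      where
      covered : ∀ x → x ∈ (A ∪ C) ∪ (B ∩ D)
      covered x with side A∪B≡⊤ x | side C∪D≡⊤ x
      ... | inj₁ x∈A | _        = x∈p∪q⁺ (inj₁ (x∈p∪q⁺ (inj₁ x∈A)))
      ... | inj₂ _   | inj₁ x∈C = x∈p∪q⁺ (inj₁ (x∈p∪q⁺ (inj₂ x∈C)))
      ... | inj₂ x∈B | inj₂ x∈D = x∈p∪q⁺ (inj₂ (x∈p∩q⁺ (x∈B , x∈D)))
    -- v lies in B ∩ D; u lies outside B ∩ D, hence strictly on the left of
    -- one of the two separations, across which it cannot be adjacent to v.
    noEdge : ∀ u v → u ∈ A ∪ C → u ∉ B ∩ D → v ∈ B ∩ D → v ∉ A ∪ C → ¬ E u v
    noEdge u v _ u∉B∩D v∈B∩D v∉A∪C with x∈p∩q⁻ B D v∈B∩D | u ∈? B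
    ... | v∈B , _ | no u∉B =
      noEdge₁ u v (left-side A∪B≡⊤ u∉B) u∉B v∈B (λ v∈A → v∉A∪C (x∈p∪q⁺ (inj₁ v∈A)))
    ... | _ , v∈D | yes u∈B =
      noEdge₂ u v (left-side C∪D≡⊤ u∉D) u∉D v∈D (λ v∈C → v∉A∪C (x∈p∪q⁺ (inj₂ v∈C)))
      where
      u∉D : u ∉ D
      u∉D u∈D = u∉B∩D (x∈p∩q⁺ (u∈B , u∈D))

  corner-separator-⊆ : ∀ {A B C D : Subset n} → A ∩ B ⊆ C → (A ∪ C) ∩ (B ∩ D) ⊆ C ∩ D
  corner-separator-⊆ {A} {B} {C} {D} X⊆C {x} x∈ with x∈p∩q⁻ (A ∪ C) (B ∩ D) x∈
  ... | x∈A∪C , x∈B∩D with x∈p∩q⁻ B D x∈B∩D | x∈p∪q⁻ A C x∈A∪C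
  ...   | x∈B , x∈D | inj₁ x∈A = x∈p∩q⁺ (X⊆C (x∈p∩q⁺ (x∈A , x∈B)) , x∈D)
  ...   | _   , x∈D | inj₂ x∈C = x∈p∩q⁺ (x∈C , x∈D)

  corner-isCliqueSep : ∀ {A B C D : Subset n} → IsSep G (A , B) → IsCliqueSep G (C , D) → A ∩ B ⊆ C →
    IsCliqueSep G ((A , B) ∨ (C , D)) × order G ((A , B) ∨ (C , D)) ≤ order G (C , D)
  corner-isCliqueSep sepα (sepβ , clique) X⊆C =
    (join-isSep sepα sepβ ,
     λ u v u∈ v∈ → clique u v (corner-separator-⊆ X⊆C u∈) (corner-separator-⊆ X⊆C v∈)) ,
    p⊆q⇒∣p∣≤∣q∣ (corner-separator-⊆ X⊆C)

  -- A profile containing α and β contains their join, if it orients it: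
  -- otherwise it would contain α, β and (α⁻¹ ∧ β⁻¹).
  join-in-profile : ∀ Q α β → P Q α → P Q β →
    IsCliqueSep G (α ∨ β) → order G (α ∨ β) < k Q → P Q (α ∨ β)
  join-in-profile Q α β Qα Qβ cs lt with Prof.orient Q (α ∨ β) cs lt
  ... | inj₁ Qα∨β = Qα∨β
  ... | inj₂ Qα∨β⁻¹ = ⊥-elim (Prof.profile Q α β Qα Qβ Qα∨β⁻¹)

  -- A profile containing α and β⁻¹ contains (α ∨ β)⁻¹, if it orients α ∨ β:
  -- otherwise β < α ∨ β would contradict consistency, unless β = α ∨ β, in
  -- which case the profile would contain both β and β⁻¹.
  join-inverse-in-profile : ∀ Q α β → P Q α → P Q (inv G β) →
    IsCliqueSep G (α ∨ β) → order G (α ∨ β) < k Q → P Q (inv G (α ∨ β))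
  join-inverse-in-profile Q (A , B) (C , D) Qα Qβ⁻¹ cs lt with Prof.orient Q ((A , B) ∨ (C , D)) cs lt
  ... | inj₂ Qα∨β⁻¹ = Qα∨β⁻¹
  ... | inj₁ Qα∨β =
    ⊥-elim (Prof.consistent Q (D , C) ((A , B) ∨ (C , D)) Qβ⁻¹ Qα∨β
              ((q⊆p∪q A C , p∩q⊆q B D) , β≢α∨β))
    where
    β≢α∨β : (C , D) ≢ (A , B) ∨ (C , D)
    β≢α∨β β≡α∨β =
      Prof.profile Q (C , D) (C , D) Qβ Qβ
        (subst (P Q) (sym (cong₂ _,_ (∩-idem D) (∪-idem C))) Qβ⁻¹)
      where
      Qβ : P Q (C , D)
      Qβ = subst (P Q) (sym β≡α∨β) Qα∨β

  corner-distinguishes : ∀ R R' A B C D → IsSep G (A , B) → IsCliqueSep G (C , D) → A ∩ B ⊆ C →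
    P R (A , B) → P R' (A , B) → P R (C , D) → P R' (D , C) →
    let c = (A , B) ∨ (C , D) in
    IsCliqueSep G c × order G c ≤ order G (C , D) × P R c × P R' (inv G c)
  corner-distinguishes R R' A B C D sepα csβ X⊆C Rα R'α Rβ R'β⁻¹ =
    cs , c≤β , join-in-profile R (A , B) (C , D) Rα Rβ cs (≤-<-trans c≤β β<k) ,
    join-inverse-in-profile R' (A , B) (C , D) R'α R'β⁻¹ cs (≤-<-trans c≤β β<k')
    where
    cs : IsCliqueSep G ((A , B) ∨ (C , D))
    cs = proj₁ (corner-isCliqueSep sepα csβ X⊆C)
    c≤β : order G ((A , B) ∨ (C , D)) ≤ order G (C , D)
    c≤β = proj₂ (corner-isCliqueSep sepα csβ X⊆C)
    β<k : order G (C , D) < k R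
    β<k = proj₂ (Prof.P⊆Sk R (C , D) Rβ)
    β<k' : order G (C , D) < k R'
    β<k' = subst (_< k R') (order-inv (C , D)) (proj₂ (Prof.P⊆Sk R' (D , C) R'β⁻¹))

  efficient-corner : ∀ Q Q' α β → IsCliqueSep G α → P Q α → P Q' α →
    IsCliqueSep G β → P Q β → P Q' (inv G β) → LowerBound Q Q' (order G β) →
    ∃ λ c → (c ≡ α ∨ β ⊎ c ≡ α ∨ inv G β) × DistinguishesEff G Q Q' c
  efficient-corner Q Q' (A , B) (C , D) (sepα , cliqueα) Qα Q'α csβ@(sepβ , _) Qβ Q'β⁻¹ bound
    with clique-side sepβ cliqueα
  ... | inj₁ X⊆C with corner-distinguishes Q Q' A B C D sepα csβ X⊆C Qα Q'α Qβ Q'β⁻¹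
  ...   | cs , c≤β , Qc , Q'c⁻¹ =
    _ , inj₁ refl , (cs , inj₁ (Qc , Q'c⁻¹)) , λ t dt → ≤-trans c≤β (bound t dt)
  efficient-corner Q Q' (A , B) (C , D) (sepα , _) Qα Q'α csβ Qβ Q'β⁻¹ bound
    | inj₂ X⊆D with corner-distinguishes Q' Q A B D C sepα (inv-isCliqueSep (C , D) csβ) X⊆D Q'α Qα Q'β⁻¹ Qβ
  ...   | cs , c≤β⁻¹ , Q'c , Qc⁻¹ =
    _ , inj₂ refl , (cs , inj₂ (Qc⁻¹ , Q'c)) ,
    λ t dt → ≤-trans c≤β⁻¹ (≤-trans (≤-reflexive (order-inv (C , D))) (bound t dt))

  distinguishing-orientation : ∀ {Q Q' b} → Distinguishes G Q Q' b →
    ∃ λ β → Orients b β × P Q β × P Q' (inv G β)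
  distinguishing-orientation {b = b} (_ , inj₁ (Qb , Q'b⁻¹)) = b , inj₁ refl , Qb , Q'b⁻¹
  distinguishing-orientation {b = b} (_ , inj₂ (Qb⁻¹ , Q'b)) = inv G b , inj₂ refl , Qb⁻¹ , Q'b

  agreeing-orientation : ∀ Q Q' a → IsCliqueSep G a → order G a < k Q → order G a < k Q' →
    LowerBound Q Q' (order G a) → ¬ DistinguishesEff G Q Q' a →
    ∃ λ α → Orients a α × P Q α × P Q' α
  agreeing-orientation Q Q' a cs lt lt' bound not-eff
    with Prof.orient Q a cs lt | Prof.orient Q' a cs lt'
  ... | inj₁ Qa   | inj₁ Q'a   = a , inj₁ refl , Qa , Q'a
  ... | inj₂ Qa⁻¹ | inj₂ Q'a⁻¹ = inv G a , inj₂ refl , Qa⁻¹ , Q'a⁻¹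
  ... | inj₁ Qa   | inj₂ Q'a⁻¹ = ⊥-elim (not-eff ((cs , inj₁ (Qa , Q'a⁻¹)) , bound))
  ... | inj₂ Qa⁻¹ | inj₁ Q'a   = ⊥-elim (not-eff ((cs , inj₂ (Qa⁻¹ , Q'a)) , bound))

  orientations-corner : ∀ {a b α β} → Orients a α → Orients b β → IsCorner G a b (α ∨ β)
  orientations-corner (inj₁ refl) (inj₁ refl) = inj₁ refl
  orientations-corner (inj₁ refl) (inj₂ refl) = inj₂ (inj₁ refl)
  orientations-corner (inj₂ refl) (inj₁ refl) = inj₂ (inj₂ (inj₁ refl))
  orientations-corner (inj₂ refl) (inj₂ refl) = inj₂ (inj₂ (inj₂ refl))

  inv-orients : ∀ {b β} → Orients b β → Orients b (inv G β)
  inv-orients (inj₁ refl) = inj₂ refl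
  inv-orients (inj₂ refl) = inj₁ refl

  join-comm : ∀ r s → r ∨ s ≡ s ∨ r
  join-comm (A , B) (C , D) = cong₂ _,_ (∪-comm A C) (∩-comm B D)

  corner-sym : ∀ a b c → IsCorner G b a c → IsCorner G a b c
  corner-sym a b c (inj₁ e)               = inj₁ (trans e (join-comm b a))
  corner-sym a b c (inj₂ (inj₁ e))        = inj₂ (inj₂ (inj₁ (trans e (join-comm b (inv G a)))))
  corner-sym a b c (inj₂ (inj₂ (inj₁ e))) = inj₂ (inj₁ (trans e (join-comm (inv G b) a)))
  corner-sym a b c (inj₂ (inj₂ (inj₂ e))) = inj₂ (inj₂ (inj₂ (trans e (join-comm (inv G b) (inv G a)))))

  below-profile-order : ∀ R {m b β} → m ≤ order G b → Orients b β → P R β → m < k R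
  below-profile-order R {β = β} m≤b b→β Rβ =
    ≤-<-trans m≤b (subst (_< k R) (orients-order b→β) (proj₂ (Prof.P⊆Sk R β Rβ)))

  splinter-step : ∀ Q Q' a b → IsCliqueSep G a → order G a ≤ order G b →
    DistinguishesEff G Q Q' b → ¬ DistinguishesEff G Q Q' a →
    ∃ λ c → IsCorner G a b c × DistinguishesEff G Q Q' c
  splinter-step Q Q' a b csa a≤b ((csb , orients-b) , bound) not-eff
    with distinguishing-orientation {Q} {Q'} {b} (csb , orients-b)
  ... | β , b→β , Qβ , Q'β⁻¹
    with agreeing-orientation Q Q' a csa (below-profile-order Q a≤b b→β Qβ)
           (below-profile-order Q' a≤b (inv-orients b→β) Q'β⁻¹)
           (λ t dt → ≤-trans a≤b (bound t dt)) not-eff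
  ... | α , a→α , Qα , Q'α
    with efficient-corner Q Q' α β (orients-isCliqueSep a→α csa) Qα Q'α
           (orients-isCliqueSep b→β csb) Qβ Q'β⁻¹
           (subst (LowerBound Q Q') (sym (orients-order b→β)) bound)
  ... | c , inj₁ refl , eff = c , orientations-corner a→α b→β , eff
  ... | c , inj₂ refl , eff = c , orientations-corner a→α (inv-orients b→β) , eff

-- Given a ∈ A_{P,Q} ∖ A_{P',Q'} and b ∈ A_{P',Q'} ∖ A_{P,Q}, apply the splinter
-- step to the pair whose efficient distinguisher has the larger order.
lemma13 : (G : Graph) (ι : Set) (𝒫 : ι → Profile G) →
    Splinters G (DPairs G ι 𝒫) (Aeff G ι 𝒫)
lemma13 G ι 𝒫 ((p , q) , _) ((p' , q') , _) a b eff-a not-eff'-a eff'-b not-eff-b _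
  with ≤-total (order G a) (order G b)
... | inj₁ a≤b with splinter-step G (𝒫 p') (𝒫 q') a b (proj₁ (proj₁ eff-a)) a≤b eff'-b not-eff'-a
...   | c , corner , eff'-c = c , corner , inj₂ eff'-c
lemma13 G ι 𝒫 ((p , q) , _) ((p' , q') , _) a b eff-a not-eff'-a eff'-b not-eff-b _
  | inj₂ b≤a with splinter-step G (𝒫 p) (𝒫 q) b a (proj₁ (proj₁ eff'-b)) b≤a eff-a not-eff-b
...   | c , corner , eff-c = c , corner-sym G a b c corner , inj₁ eff-c
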